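{- Let $D$ be a deck of order $n$ and length $\ell$, and let $M=\max_{s\in S}m(s)$. Then $M(n-1)+1=\ell$ if and only if $M=n$, and this is also equivalent to the existence of a symbol $\tilde s$ which is aligned with every other symbol.
   Context: A deck consists of a finite set $S$ of symbols together with a finite collection $D$ of distinct cards, each card being a subset of $S$, satisfying: (D1) any two distinct cards have exactly one symbol in common; (D2) every symbol of $S$ lies on at least two cards; (D3) every card contains at least two symbols; (D4) all cards have the same cardinality $n$ (the order); (D5) $S$ is nonempty. $\ell=|S|$ is the length. For $s\in S$, the multiplicity $m(s)$ is the number of cards containing $s$. Two symbols are aligned if some card contains both of them. -}

module Defs where

open import Data.Nat using (ℕ; _≤_; _⊔_)
open import Data.Fin using (Fin)
open import Data.Fin.Subset using (Subset; _∈_; _∩_; ∣_∣)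
open import Data.Vec using (lookup; tabulate; foldr′)
open import Data.Product using (∃; _×_)
open import Relation.Binary.PropositionalEquality using (_≡_; _≢_)

-- A deck of length ℓ (symbols S = Fin ℓ) and order n.
-- The cards form a finite family indexed by Fin numCards; distinctness
-- of cards is expressed by injectivity of the indexing map.
record Deck (ℓ n : ℕ) : Set where
  field
    numCards : ℕ
    card     : Fin numCards → Subset ℓ
    distinct : ∀ i j → card i ≡ card j → i ≡ j
    D1 : ∀ i j → i ≢ j → ∣ card i ∩ card j ∣ ≡ 1
    D2 : ∀ (s : Fin ℓ) → 2 ≤ ∣ tabulate (λ i → lookup (card i) s) ∣
    D3 : ∀ i → 2 ≤ ∣ card i ∣
    D4 : ∀ i → ∣ card i ∣ ≡ n
    D5 : 1 ≤ ℓ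

module _ {ℓ n : ℕ} (D : Deck ℓ n) where
  open Deck D

  cardsContaining : Fin ℓ → Subset numCards
  cardsContaining s = tabulate (λ i → lookup (card i) s)

  multiplicity : Fin ℓ → ℕ
  multiplicity s = ∣ cardsContaining s ∣

  -- M = max over s ∈ S of m(s)  (S is nonempty by D5)
  maxMultiplicity : ℕ
  maxMultiplicity = foldr′ _⊔_ 0 (tabulate multiplicity)

  Aligned : Fin ℓ → Fin ℓ → Set
  Aligned s t = ∃ λ i → s ∈ card i × t ∈ card i

-- Let s be a symbol of multiplicity m and c a card avoiding s (one exists: a second
-- symbol t of a card through s lies on a second card, which cannot contain s since two
-- cards share only one symbol). The cards through s meet c in pairwise distinct
-- symbols, so m ≤ n. If s is aligned with every symbol, the cards joining s to the
-- symbols of c are pairwise distinct, so n ≤ m; conversely, if m = n the injection into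
-- a card c through t is onto, so t is joined to s by a card.
-- Double counting the pairs (t, i) with s and t on card i gives Σₜ λ(s,t) = m n, where
-- λ(s,t) = ∣ commonCards s t ∣ is m for t = s and at most 1 otherwise; so s is aligned
-- with at most m(n − 1) other symbols, and with all ℓ − 1 of them iff m(n − 1) + 1 = ℓ.
-- Apply all this to a symbol of maximal multiplicity.

module Submission where

open import Defs

open import Data.Bool.Base using (Bool; true; false; _∧_)
open import Data.Fin.Base using (Fin; zero; suc; punchIn; punchOut; fromℕ<)
open import Data.Fin.Properties using (_≟_; any?; punchInᵢ≢i; punchIn-punchOut)
import Data.Fin.Properties as Finₚ
open import Data.Fin.Subset using (Subset; _∩_; _∈_; _∉_; _-_; ⁅_⁆; ∣_∣; Nonempty; Empty; inside; outside)
open import Data.Fin.Subset.Properties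
  using (_∈?_; nonempty?; Empty-unique; ∣⊥∣≡0; ∣⁅x⁆∣≡1; x∈⁅x⁆; p⊆q⇒∣p∣≤∣q∣; x∈p⇒∣p-x∣<∣p∣;
         x∈p∧x≢y⇒x∈p-y; x∈p∩q⁺; x∈p∩q⁻; ∩-idem)
open import Data.Nat.Base using (ℕ; zero; suc; _+_; _*_; _∸_; _≤_; _<_; _⊔_; z≤n; s≤s)
open import Data.Nat.Properties
  using (+-*-semiring; +-comm; *-suc; +-identityʳ; +-mono-≤; +-monoʳ-≤; +-cancelʳ-≤; +-cancelˡ-≡;
         suc-injective; ≤-antisym; ≤-trans; ≤-reflexive; ≤-<-trans; <-≤-trans; <⇒≱; >⇒≢;
         m≤m⊔n; m≤n⊔m; ⊔-identityʳ; ⊔-sel; module ≤-Reasoning)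
open import Data.Product.Base using (∃; _×_; _,_; proj₁; proj₂)
open import Data.Sum.Base using (inj₁; inj₂)
open import Data.Vec.Base using ([]; _∷_; here; there; lookup; tabulate; foldr′)
open import Data.Vec.Functional using (removeAt)
open import Data.Vec.Properties using (lookup∘tabulate; lookup-zipWith; lookup⇒[]=; []=⇒lookup)
open import Function.Base using (_∘_)
open import Function.Bundles using (_⇔_; mk⇔; Equivalence)
open import Function.Properties.Equivalence using (⇔-setoid) renaming (sym to ⇔-sym; trans to ⇔-trans)
open import Level using (0ℓ)
open import Relation.Nullary.Decidable using (yes; no; decidable-stable; _×-dec_; ¬?)
open import Relation.Nullary.Negation using (contradiction)
open import Relation.Binary.PropositionalEquality
  using (_≡_; _≢_; refl; sym; trans; cong; cong₂; subst; module ≡-Reasoning)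
import Relation.Binary.Reasoning.Setoid as SetoidReasoning
open import Algebra.Properties.Semiring.Sum +-*-semiring
  using (sum; sum-syntax; sum-remove; ∑-comm; sum-cong-≗; *-distribˡ-sum; *-distribʳ-sum)

module _ {k : ℕ} where

  Empty⇒∣p∣≡0 : {p : Subset k} → Empty p → ∣ p ∣ ≡ 0
  Empty⇒∣p∣≡0 ¬ne = trans (cong ∣_∣ (Empty-unique ¬ne)) (∣⊥∣≡0 k)

  ∣p∣>0⇒nonempty : {p : Subset k} → 0 < ∣ p ∣ → Nonempty p
  ∣p∣>0⇒nonempty {p} ∣p∣>0 with nonempty? p
  ... | yes ne = ne
  ... | no ¬ne = contradiction (Empty⇒∣p∣≡0 ¬ne) (>⇒≢ ∣p∣>0)

  x∈p⇒∣p∣>0 : ∀ {p : Subset k} {x} → x ∈ p → 0 < ∣ p ∣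
  x∈p⇒∣p∣>0 x∈p = ≤-<-trans z≤n (x∈p⇒∣p-x∣<∣p∣ x∈p)

  x∈p∧y∈p∧x≢y⇒∣p∣≥2 : ∀ {p : Subset k} {x y} → x ∈ p → y ∈ p → x ≢ y → 2 ≤ ∣ p ∣
  x∈p∧y∈p∧x≢y⇒∣p∣≥2 x∈p y∈p x≢y =
    <-≤-trans (s≤s (x∈p⇒∣p∣>0 (x∈p∧x≢y⇒x∈p-y y∈p (x≢y ∘ sym)))) (x∈p⇒∣p-x∣<∣p∣ x∈p)

  subsingleton⇒∣p∣≤1 : {p : Subset k} → (∀ {x y} → x ∈ p → y ∈ p → x ≡ y) → ∣ p ∣ ≤ 1
  subsingleton⇒∣p∣≤1 {p} unique with nonempty? p
  ... | no ¬ne = ≤-trans (≤-reflexive (Empty⇒∣p∣≡0 ¬ne)) z≤n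
  ... | yes (x , x∈p) = ≤-trans (p⊆q⇒∣p∣≤∣q∣ p⊆⁅x⁆) (≤-reflexive (∣⁅x⁆∣≡1 x))
    where
    p⊆⁅x⁆ : ∀ {y} → y ∈ p → y ∈ ⁅ x ⁆
    p⊆⁅x⁆ y∈p = subst (_∈ ⁅ x ⁆) (unique x∈p y∈p) (x∈⁅x⁆ x)

  ∣p∣≥2⇒another : {p : Subset k} → 2 ≤ ∣ p ∣ → ∀ {x} → x ∈ p → ∃ λ y → y ∈ p × y ≢ x
  ∣p∣≥2⇒another {p} ∣p∣≥2 {x} x∈p with any? (λ y → (y ∈? p) ×-dec ¬? (y ≟ x))
  ... | yes found = found
  ... | no none = contradiction (subsingleton⇒∣p∣≤1 equal) (<⇒≱ ∣p∣≥2)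
    where
    ≡x : ∀ {y} → y ∈ p → y ≡ x
    ≡x {y} y∈p = decidable-stable (y ≟ x) (λ y≢x → none (y , y∈p , y≢x))
    equal : ∀ {y z} → y ∈ p → z ∈ p → y ≡ z
    equal y∈p z∈p = trans (≡x y∈p) (sym (≡x z∈p))

injective⇒∣p∣≤∣q∣ : ∀ {a b} (f : Fin a → Fin b) {p : Subset a} {q : Subset b} →
  (∀ {x} → x ∈ p → f x ∈ q) →
  (∀ {x y} → x ∈ p → y ∈ p → f x ≡ f y → x ≡ y) →
  ∣ p ∣ ≤ ∣ q ∣
injective⇒∣p∣≤∣q∣ f {[]} _ _ = z≤n
injective⇒∣p∣≤∣q∣ f {outside ∷ p} maps inj =
  injective⇒∣p∣≤∣q∣ (f ∘ suc) (maps ∘ there) (λ x∈p y∈p → Finₚ.suc-injective ∘ inj (there x∈p) (there y∈p))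
injective⇒∣p∣≤∣q∣ f {inside ∷ p} {q} maps inj = begin-strict
  ∣ p ∣             ≤⟨ injective⇒∣p∣≤∣q∣ (f ∘ suc) maps′ (λ x∈p y∈p → Finₚ.suc-injective ∘ inj (there x∈p) (there y∈p)) ⟩
  ∣ q - f zero ∣    <⟨ x∈p⇒∣p-x∣<∣p∣ (maps here) ⟩
  ∣ q ∣             ∎
  where
  open ≤-Reasoning
  maps′ : ∀ {x} → x ∈ p → f (suc x) ∈ q - f zero
  maps′ x∈p = x∈p∧x≢y⇒x∈p-y (maps (there x∈p)) (Finₚ.0≢1+n ∘ sym ∘ inj (there x∈p) here)

injective∧∣q∣≤∣p∣⇒surjective : ∀ {a b} (f : Fin a → Fin b) {p : Subset a} {q : Subset b} →
  (∀ {x} → x ∈ p → f x ∈ q) →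
  (∀ {x y} → x ∈ p → y ∈ p → f x ≡ f y → x ≡ y) →
  ∣ q ∣ ≤ ∣ p ∣ →
  ∀ {y} → y ∈ q → ∃ λ x → x ∈ p × f x ≡ y
injective∧∣q∣≤∣p∣⇒surjective f {p} {q} maps inj ∣q∣≤∣p∣ {y} y∈q
  with any? (λ x → (x ∈? p) ×-dec (f x ≟ y))
... | yes hit = hit
... | no missed = contradiction (≤-trans ∣q∣≤∣p∣ ∣p∣≤∣q-y∣) (<⇒≱ (x∈p⇒∣p-x∣<∣p∣ y∈q))
  where
  ∣p∣≤∣q-y∣ : ∣ p ∣ ≤ ∣ q - y ∣
  ∣p∣≤∣q-y∣ = injective⇒∣p∣≤∣q∣ f (λ {x} x∈p → x∈p∧x≢y⇒x∈p-y (maps x∈p) (λ fx≡y → missed (x , x∈p , fx≡y))) inj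

indicator : Bool → ℕ
indicator true  = 1
indicator false = 0

indicator-∧ : ∀ x y → indicator (x ∧ y) ≡ indicator x * indicator y
indicator-∧ true  y = sym (+-identityʳ (indicator y))
indicator-∧ false y = refl

∣p∣≡∑indicator : ∀ {k} (p : Subset k) → ∣ p ∣ ≡ ∑[ i < k ] indicator (lookup p i)
∣p∣≡∑indicator []            = refl
∣p∣≡∑indicator (inside ∷ p)  = cong suc (∣p∣≡∑indicator p)
∣p∣≡∑indicator (outside ∷ p) = ∣p∣≡∑indicator p

∑f≤k : ∀ {k} (f : Fin k → ℕ) → (∀ i → f i ≤ 1) → sum f ≤ k
∑f≤k {zero}  f f≤1 = z≤n
∑f≤k {suc k} f f≤1 = +-mono-≤ (f≤1 zero) (∑f≤k (f ∘ suc) (f≤1 ∘ suc))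

∑f≡k⇔fᵢ≡1 : ∀ {k} (f : Fin k → ℕ) → (∀ i → f i ≤ 1) → (sum f ≡ k ⇔ ∀ i → f i ≡ 1)
∑f≡k⇔fᵢ≡1 {zero}  f f≤1 = mk⇔ (λ _ ()) (λ _ → refl)
∑f≡k⇔fᵢ≡1 {suc k} f f≤1 = mk⇔ to from
  where
  open Equivalence (∑f≡k⇔fᵢ≡1 (f ∘ suc) (f≤1 ∘ suc))
    renaming (to to rest-to; from to rest-from)
  to : f zero + sum (f ∘ suc) ≡ suc k → ∀ i → f i ≡ 1
  to ∑≡1+k = λ { zero → f₀≡1 ; (suc i) → rest-to ∑rest≡k i }
    where
    f₀≡1 : f zero ≡ 1
    f₀≡1 = ≤-antisym (f≤1 zero)
      (+-cancelʳ-≤ k 1 (f zero)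
        (≤-trans (≤-reflexive (sym ∑≡1+k)) (+-monoʳ-≤ (f zero) (∑f≤k (f ∘ suc) (f≤1 ∘ suc)))))
    ∑rest≡k : sum (f ∘ suc) ≡ k
    ∑rest≡k = suc-injective (trans (cong (_+ sum (f ∘ suc)) (sym f₀≡1)) ∑≡1+k)
  from : (∀ i → f i ≡ 1) → f zero + sum (f ∘ suc) ≡ suc k
  from all≡1 = cong₂ _+_ (all≡1 zero) (rest-from (all≡1 ∘ suc))

∑f≡fᵢ+k∸1⇔fⱼ≡1 : ∀ {k} (f : Fin k → ℕ) (i : Fin k) → (∀ j → j ≢ i → f j ≤ 1) →
  (sum f ≡ f i + (k ∸ 1) ⇔ ∀ j → j ≢ i → f j ≡ 1)
∑f≡fᵢ+k∸1⇔fⱼ≡1 {suc k} f i others≤1 = mk⇔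
  (λ ∑≡ j j≢i → subst (λ t → f t ≡ 1) (punchIn-punchOut (j≢i ∘ sym))
     (to (+-cancelˡ-≡ (f i) _ _ (trans (sym (sum-remove {i = i} f)) ∑≡)) (punchOut (j≢i ∘ sym))))
  (λ others≡1 → trans (sum-remove {i = i} f)
     (cong (f i +_) (from (λ j → others≡1 (punchIn i j) (punchInᵢ≢i i j)))))
  where
  open Equivalence (∑f≡k⇔fᵢ≡1 (removeAt f i) (λ j → others≤1 (punchIn i j) (punchInᵢ≢i i j)))

fᵢ≤max : ∀ {k} (f : Fin k → ℕ) i → f i ≤ foldr′ _⊔_ 0 (tabulate f)
fᵢ≤max f zero    = m≤m⊔n (f zero) _
fᵢ≤max f (suc i) = ≤-trans (fᵢ≤max (f ∘ suc) i) (m≤n⊔m (f zero) _)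

max-attained : ∀ {k} (f : Fin k → ℕ) → 0 < k → ∃ λ i → f i ≡ foldr′ _⊔_ 0 (tabulate f)
max-attained {suc zero}    f _ = zero , sym (⊔-identityʳ (f zero))
max-attained {suc (suc k)} f _ with max-attained (f ∘ suc) (s≤s z≤n) | ⊔-sel (f zero) (foldr′ _⊔_ 0 (tabulate (f ∘ suc)))
... | _ , _    | inj₁ max≡f₀   = zero , sym max≡f₀
... | i , fᵢ≡m | inj₂ max≡rest = suc i , trans fᵢ≡m (sym max≡rest)

m*n≡m+[ℓ∸1]⇔m*[n∸1]+1≡ℓ : ∀ {a b m n ℓ} → a ≡ m * n → b ≡ m → 1 ≤ n → 1 ≤ ℓ →
  (a ≡ b + (ℓ ∸ 1) ⇔ m * (n ∸ 1) + 1 ≡ ℓ)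
m*n≡m+[ℓ∸1]⇔m*[n∸1]+1≡ℓ {m = m} {suc n} {suc ℓ} refl refl _ _ = mk⇔
  (λ e → trans (+-comm (m * n) 1) (cong suc (+-cancelˡ-≡ m _ _ (trans (sym (*-suc m n)) e))))
  (λ e → trans (*-suc m n) (cong (m +_) (suc-injective (trans (+-comm 1 (m * n)) e))))

module _ {ℓ n : ℕ} (D : Deck ℓ n) where
  open Deck D

  AlignedWithAll : Fin ℓ → Set
  AlignedWithAll s = ∀ t → t ≢ s → Aligned D s t

  ∈-cardsContaining⁺ : ∀ {s i} → s ∈ card i → i ∈ cardsContaining D s
  ∈-cardsContaining⁺ {s} {i} s∈i =
    lookup⇒[]= i _ (trans (lookup∘tabulate _ i) ([]=⇒lookup s∈i))

  ∈-cardsContaining⁻ : ∀ {s i} → i ∈ cardsContaining D s → s ∈ card i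
  ∈-cardsContaining⁻ {s} {i} i∈ =
    lookup⇒[]= s (card i) (trans (sym (lookup∘tabulate _ i)) ([]=⇒lookup i∈))

  commonSymbol : ∀ {i j} → i ≢ j → ∃ λ s → s ∈ card i × s ∈ card j
  commonSymbol {i} {j} i≢j with ∣p∣>0⇒nonempty (≤-reflexive (sym (D1 i j i≢j)))
  ... | s , s∈i∩j = s , x∈p∩q⁻ (card i) (card j) s∈i∩j

  commonSymbol-unique : ∀ {i j s t} → i ≢ j →
    s ∈ card i → s ∈ card j → t ∈ card i → t ∈ card j → s ≡ t
  commonSymbol-unique {i} {j} {s} {t} i≢j s∈i s∈j t∈i t∈j =
    decidable-stable (s ≟ t) λ s≢t →
      <⇒≱ (x∈p∧y∈p∧x≢y⇒∣p∣≥2 (x∈p∩q⁺ (s∈i , s∈j)) (x∈p∩q⁺ (t∈i , t∈j)) s≢t)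
          (≤-reflexive (D1 i j i≢j))

  cardThrough : ∀ s → ∃ λ i → s ∈ card i
  cardThrough s with ∣p∣>0⇒nonempty (≤-trans (s≤s z≤n) (D2 s))
  ... | i , i∈ = i , ∈-cardsContaining⁻ i∈

  cardAvoiding : ∀ s → ∃ λ c → s ∉ card c
  cardAvoiding s with cardThrough s
  ... | i , s∈i with ∣p∣≥2⇒another (D3 i) s∈i
  ... | t , t∈i , t≢s with ∣p∣≥2⇒another (D2 t) (∈-cardsContaining⁺ t∈i)
  ... | j , j∈ , j≢i =
    j , λ s∈j → t≢s (sym (commonSymbol-unique j≢i s∈j s∈i (∈-cardsContaining⁻ j∈) t∈i))

  order>0 : 0 < n
  order>0 with cardThrough (fromℕ< D5)
  ... | i , _ = ≤-trans (s≤s z≤n) (subst (2 ≤_) (D4 i) (D3 i))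

  module _ {s : Fin ℓ} {c : Fin numCards} (s∉c : s ∉ card c) where

    -- The value at c itself is junk: c is not among the cards through s.
    meet : Fin numCards → Fin ℓ
    meet i with i ≟ c
    ... | yes _   = s
    ... | no i≢c = proj₁ (commonSymbol i≢c)

    meet-common : ∀ {i} → i ∈ cardsContaining D s → meet i ∈ card i × meet i ∈ card c
    meet-common {i} i∈ with i ≟ c
    ... | yes refl = contradiction (∈-cardsContaining⁻ i∈) s∉c
    ... | no i≢c  = proj₂ (commonSymbol i≢c)

    meet-injective : ∀ {i j} → i ∈ cardsContaining D s → j ∈ cardsContaining D s →
      meet i ≡ meet j → i ≡ j
    meet-injective {i} {j} i∈ j∈ meetᵢ≡meetⱼ = decidable-stable (i ≟ j) λ i≢j →
      s∉c (subst (_∈ card c) (sym (s≡meetᵢ i≢j)) (proj₂ (meet-common i∈)))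
      where
      s≡meetᵢ : i ≢ j → s ≡ meet i
      s≡meetᵢ i≢j = commonSymbol-unique i≢j
        (∈-cardsContaining⁻ i∈) (∈-cardsContaining⁻ j∈)
        (proj₁ (meet-common i∈)) (subst (_∈ card j) (sym meetᵢ≡meetⱼ) (proj₁ (meet-common j∈)))

    multiplicity≤∣card∣ : multiplicity D s ≤ ∣ card c ∣
    multiplicity≤∣card∣ = injective⇒∣p∣≤∣q∣ meet (proj₂ ∘ meet-common) meet-injective

  multiplicity≤order : ∀ s → multiplicity D s ≤ n
  multiplicity≤order s with cardAvoiding s
  ... | c , s∉c = subst (multiplicity D s ≤_) (D4 c) (multiplicity≤∣card∣ s∉c)

  multiplicity≡order⇒alignedWithAll : ∀ {s} → multiplicity D s ≡ n → AlignedWithAll s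
  multiplicity≡order⇒alignedWithAll {s} m≡n t t≢s with cardThrough t
  ... | i , t∈i with s ∈? card i
  ... | yes s∈i = i , s∈i , t∈i
  ... | no s∉i with injective∧∣q∣≤∣p∣⇒surjective (meet s∉i) (proj₂ ∘ meet-common s∉i)
                      (meet-injective s∉i) (≤-reflexive (trans (D4 i) (sym m≡n))) t∈i
  ... | j , j∈ , meetⱼ≡t =
    j , ∈-cardsContaining⁻ j∈ , subst (_∈ card j) meetⱼ≡t (proj₁ (meet-common s∉i j∈))

  module _ {s : Fin ℓ} (aligned : AlignedWithAll s) {c : Fin numCards} (s∉c : s ∉ card c) where

    partner : Fin ℓ → Fin numCards
    partner t with t ≟ s
    ... | yes _   = c
    ... | no t≢s = proj₁ (aligned t t≢s)

    partner-common : ∀ {t} → t ∈ card c → s ∈ card (partner t) × t ∈ card (partner t)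
    partner-common {t} t∈c with t ≟ s
    ... | yes refl = contradiction t∈c s∉c
    ... | no t≢s  = proj₂ (aligned t t≢s)

    partner-injective : ∀ {t u} → t ∈ card c → u ∈ card c → partner t ≡ partner u → t ≡ u
    partner-injective {t} {u} t∈c u∈c partnerₜ≡partnerᵤ =
      commonSymbol-unique partnerₜ≢c (proj₂ (partner-common t∈c)) t∈c
        (subst (λ i → u ∈ card i) (sym partnerₜ≡partnerᵤ) (proj₂ (partner-common u∈c))) u∈c
      where
      partnerₜ≢c : partner t ≢ c
      partnerₜ≢c partnerₜ≡c = s∉c (subst (λ i → s ∈ card i) partnerₜ≡c (proj₁ (partner-common t∈c)))

    ∣card∣≤multiplicity : ∣ card c ∣ ≤ multiplicity D s
    ∣card∣≤multiplicity = injective⇒∣p∣≤∣q∣ partner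
      (∈-cardsContaining⁺ ∘ proj₁ ∘ partner-common) partner-injective

  alignedWithAll⇒order≤multiplicity : ∀ {s} → AlignedWithAll s → n ≤ multiplicity D s
  alignedWithAll⇒order≤multiplicity {s} aligned with cardAvoiding s
  ... | c , s∉c = subst (_≤ multiplicity D s) (D4 c) (∣card∣≤multiplicity aligned s∉c)

  alignedWithAll⇔multiplicity≡order : ∀ s → AlignedWithAll s ⇔ multiplicity D s ≡ n
  alignedWithAll⇔multiplicity≡order s = mk⇔
    (λ aligned → ≤-antisym (multiplicity≤order s) (alignedWithAll⇒order≤multiplicity aligned))
    multiplicity≡order⇒alignedWithAll

  commonCards : Fin ℓ → Fin ℓ → Subset numCards
  commonCards s t = cardsContaining D s ∩ cardsContaining D t

  ∈-commonCards⁺ : ∀ {s t i} → s ∈ card i → t ∈ card i → i ∈ commonCards s t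
  ∈-commonCards⁺ s∈i t∈i = x∈p∩q⁺ (∈-cardsContaining⁺ s∈i , ∈-cardsContaining⁺ t∈i)

  ∈-commonCards⁻ : ∀ {s t i} → i ∈ commonCards s t → s ∈ card i × t ∈ card i
  ∈-commonCards⁻ {s} {t} i∈ with x∈p∩q⁻ (cardsContaining D s) (cardsContaining D t) i∈
  ... | i∈s , i∈t = ∈-cardsContaining⁻ i∈s , ∈-cardsContaining⁻ i∈t

  ∣commonCards∣≤1 : ∀ {s t} → t ≢ s → ∣ commonCards s t ∣ ≤ 1
  ∣commonCards∣≤1 t≢s = subsingleton⇒∣p∣≤1 λ {i} {j} i∈ j∈ →
    let (s∈i , t∈i) = ∈-commonCards⁻ i∈
        (s∈j , t∈j) = ∈-commonCards⁻ j∈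
    in decidable-stable (i ≟ j) λ i≢j → t≢s (sym (commonSymbol-unique i≢j s∈i s∈j t∈i t∈j))

  aligned⇔∣commonCards∣≡1 : ∀ {s t} → t ≢ s → (Aligned D s t ⇔ ∣ commonCards s t ∣ ≡ 1)
  aligned⇔∣commonCards∣≡1 t≢s = mk⇔
    (λ (i , s∈i , t∈i) → ≤-antisym (∣commonCards∣≤1 t≢s) (x∈p⇒∣p∣>0 (∈-commonCards⁺ s∈i t∈i)))
    (λ ∣common∣≡1 → let (i , i∈) = ∣p∣>0⇒nonempty (≤-reflexive (sym ∣common∣≡1))
                    in i , ∈-commonCards⁻ i∈)

  ∑∣commonCards∣≡multiplicity*order : ∀ s → ∑[ t < ℓ ] ∣ commonCards s t ∣ ≡ multiplicity D s * n
  ∑∣commonCards∣≡multiplicity*order s = begin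
    ∑[ t < ℓ ] ∣ commonCards s t ∣
      ≡⟨ sum-cong-≗ (λ t → trans (∣p∣≡∑indicator (commonCards s t)) (sum-cong-≗ (entry t))) ⟩
    ∑[ t < ℓ ] ∑[ i < numCards ] (incidence i s * incidence i t)
      ≡⟨ ∑-comm (λ t i → incidence i s * incidence i t) ⟩
    ∑[ i < numCards ] ∑[ t < ℓ ] (incidence i s * incidence i t)
      ≡⟨ sum-cong-≗ (λ i → sym (*-distribˡ-sum (incidence i s) (incidence i))) ⟩
    ∑[ i < numCards ] (incidence i s * ∑[ t < ℓ ] incidence i t)
      ≡⟨ sum-cong-≗ (λ i → cong (incidence i s *_) (trans (sym (∣p∣≡∑indicator (card i))) (D4 i))) ⟩
    ∑[ i < numCards ] (incidence i s * n)
      ≡⟨ sym (*-distribʳ-sum n (λ i → incidence i s)) ⟩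
    (∑[ i < numCards ] incidence i s) * n
      ≡⟨ cong (_* n) (sym multiplicity≡∑incidence) ⟩
    multiplicity D s * n ∎
    where
    open ≡-Reasoning
    incidence : Fin numCards → Fin ℓ → ℕ
    incidence i t = indicator (lookup (card i) t)
    lookup-cardsContaining : ∀ t i → lookup (cardsContaining D t) i ≡ lookup (card i) t
    lookup-cardsContaining t = lookup∘tabulate (λ i → lookup (card i) t)
    entry : ∀ t i → indicator (lookup (commonCards s t) i) ≡ incidence i s * incidence i t
    entry t i = trans
      (cong indicator (trans (lookup-zipWith _∧_ i (cardsContaining D s) (cardsContaining D t))
        (cong₂ _∧_ (lookup-cardsContaining s i) (lookup-cardsContaining t i))))
      (indicator-∧ (lookup (card i) s) (lookup (card i) t))
    multiplicity≡∑incidence : multiplicity D s ≡ ∑[ i < numCards ] incidence i s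
    multiplicity≡∑incidence = trans (∣p∣≡∑indicator (cardsContaining D s))
      (sum-cong-≗ (cong indicator ∘ lookup-cardsContaining s))

  alignedWithAll⇔countingIdentity : ∀ s → AlignedWithAll s ⇔ multiplicity D s * (n ∸ 1) + 1 ≡ ℓ
  alignedWithAll⇔countingIdentity s = begin
    AlignedWithAll s
      ≈⟨ mk⇔ (λ aligned t t≢s → Equivalence.to (aligned⇔∣commonCards∣≡1 t≢s) (aligned t t≢s))
             (λ common t t≢s → Equivalence.from (aligned⇔∣commonCards∣≡1 t≢s) (common t t≢s)) ⟩
    (∀ t → t ≢ s → ∣ commonCards s t ∣ ≡ 1)
      ≈⟨ ⇔-sym (∑f≡fᵢ+k∸1⇔fⱼ≡1 (λ t → ∣ commonCards s t ∣) s (λ t → ∣commonCards∣≤1)) ⟩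
    (∑[ t < ℓ ] ∣ commonCards s t ∣ ≡ ∣ commonCards s s ∣ + (ℓ ∸ 1))
      ≈⟨ m*n≡m+[ℓ∸1]⇔m*[n∸1]+1≡ℓ (∑∣commonCards∣≡multiplicity*order s)
           (cong ∣_∣ (∩-idem (cardsContaining D s))) order>0 D5 ⟩
    multiplicity D s * (n ∸ 1) + 1 ≡ ℓ ∎
    where
    open SetoidReasoning (⇔-setoid 0ℓ)

mainTheorem9 : ∀ {ℓ n : ℕ} (D : Deck ℓ n) →
    ((maxMultiplicity D * (n ∸ 1) + 1 ≡ ℓ) ⇔ (maxMultiplicity D ≡ n))
    × ((maxMultiplicity D ≡ n)
        ⇔ (∃ λ (s̃ : Fin ℓ) → ∀ (t : Fin ℓ) → t ≢ s̃ → Aligned D s̃ t))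
mainTheorem9 {ℓ} {n} D =
  subst (λ m → m * (n ∸ 1) + 1 ≡ ℓ ⇔ m ≡ n) mₛ₀≡M
    (⇔-trans (⇔-sym (alignedWithAll⇔countingIdentity D s₀)) (alignedWithAll⇔multiplicity≡order D s₀))
  , mk⇔
    (λ M≡n → s₀ , Equivalence.from (alignedWithAll⇔multiplicity≡order D s₀) (trans mₛ₀≡M M≡n))
    (λ (s , aligned) → ≤-antisym
      (subst (_≤ n) mₛ₀≡M (multiplicity≤order D s₀))
      (≤-trans (alignedWithAll⇒order≤multiplicity D aligned) (fᵢ≤max (multiplicity D) s)))
  where
  s₀ : Fin ℓ
  s₀ = proj₁ (max-attained (multiplicity D) (Deck.D5 D))
  mₛ₀≡M : multiplicity D s₀ ≡ maxMultiplicity D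
  mₛ₀≡M = proj₂ (max-attained (multiplicity D) (Deck.D5 D))
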